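{- Let $N\geq\ell\geq k\geq 3$ be integers, let $c:[N]^{(k-1)}\to\mathbb{Z}_4$ be a coloring and let $\chi_c:[2^N]^{(k)}\to\mathbb{Z}_4$ be the induced coloring. Let $Y=\{y_0<y_1<\dots<y_\ell\}\subseteq[2^N]$ satisfy: (a) $Y$ forms a left comb; (b) for every $J\in\{2,\dots,\ell\}^{(k-1)}$ there is a leaf $y_J\in[2^N]$ with $y_0\leq y_J\leq y_1$ (different $J$ may give the same $y_J$); (c) there exists $\alpha\in\mathbb{Z}_4$ such that $\chi_c(\{y_J\}\cup\{y_j:j\in J\})=\alpha$ for every $J\in\{2,\dots,\ell\}^{(k-1)}$. Then $c$ is constant on $\pi(Y\setminus\{y_0\})^{(k-1)}$.
   Context: Identify each $x\in[2^N]$ with the binary string of length $N$ representing $x-1$; these are the leaves, in left-to-right order, of the complete binary tree $T(N)$ with levels $1$ (root) to $N+1$ (leaves), a vertex at level $d$ corresponding to a binary string of length $d-1$. For distinct leaves $x,y$, $a(x,y)$ is their greatest common ancestor (their longest common prefix) and $\delta(x,y)$ is its level (one plus the length of the longest common prefix). For a set $X$ of at least two leaves let $u_X=a(\min X,\max X)$, and let $X_L(u_X)$ (resp. $X_R(u_X)$) be the elements of $X$ in the subtree of the left (resp. right) child of $u_X$. For $X=\{x_1<\dots<x_t\}$ let $\pi(X)=\{\delta(x_{i-1},x_i):2\leq i\leq t\}\subseteq[N]$. For $t\geq 3$, $X$ forms a left comb if $\delta(x_1,x_2)>\delta(x_2,x_3)>\dots>\delta(x_{t-1},x_t)$, and a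 right comb if $\delta(x_1,x_2)<\dots<\delta(x_{t-1},x_t)$. If $X$ is neither, it forms an $(\ell',r)$-split where $\ell'=|X_L(u_X)|$, $r=|X_R(u_X)|$; it is a balanced split if $\ell',r\geq 2$. Induced coloring: for $k=3$, $\chi_c(X)=c(\pi(X))$ if $X$ is a left comb and $\chi_c(X)=3-c(\pi(X))$ if $X$ is a right comb (every 3-set is one of these). For $k\geq 4$, $\chi_c(X)=3-c(\pi(X))$ if $X$ is a left comb, $c(\pi(X))$ if $X$ is a right comb, $0$ if $X$ is a balanced split, $1$ if $X$ is a $(k-1,1)$-split, $2$ if $X$ is a $(1,k-1)$-split. Arithmetic is in $\mathbb{Z}_4$. -}

module Defs where

open import Data.Bool using (Bool; true; false; _∧_; _∨_; if_then_else_; not)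
open import Data.Nat using (ℕ; zero; suc; _<ᵇ_; _≡ᵇ_; _≤_; _<_; _∸_)
open import Data.Fin using (Fin; toℕ) renaming (zero to fzero; suc to fsuc)
open import Data.Fin.Subset using (Subset; Side; inside; outside)
open import Data.List using (List; []; _∷_; _++_; length; filter; map)
open import Data.Bool.ListAction using (any)
open import Data.Vec using (Vec; []; _∷_; toList; tabulate)
open import Relation.Nullary.Decidable using (Dec; yes; no)
open import Relation.Binary.PropositionalEquality using (_≡_; refl)
open import Relation.Nullary.Decidable using (T?)
open import Data.Bool using (T)

-- Leaves of T(N): binary strings of length N (leaf x ∈ [2^N] is the
-- binary expansion of x-1, most significant bit = first step from the
-- root, false = left child, true = right child).

Leaf : ℕ → Set
Leaf N = Vec Bool N

data _<ᴸ_ : {n : ℕ} → Vec Bool n → Vec Bool n → Set where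
  here  : {n : ℕ} {u v : Vec Bool n} → (false ∷ u) <ᴸ (true ∷ v)
  there : {n : ℕ} {b : Bool} {u v : Vec Bool n} → u <ᴸ v → (b ∷ u) <ᴸ (b ∷ v)

_≤ᴸ_ : {n : ℕ} → Vec Bool n → Vec Bool n → Set
x ≤ᴸ y = x ≡ y ⊎' x <ᴸ y
  where
  open import Data.Sum using () renaming (_⊎_ to _⊎'_)

eqBool : Bool → Bool → Bool
eqBool true  true  = true
eqBool false false = true
eqBool _     _     = false

lcp : {n : ℕ} → Vec Bool n → Vec Bool n → List Bool
lcp []      []      = []
lcp (a ∷ u) (b ∷ v) = if eqBool a b then a ∷ lcp u v else []

-- δ(x,y) = level of a(x,y) = 1 + length of longest common prefix.
δ : {n : ℕ} → Vec Bool n → Vec Bool n → ℕ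
δ x y = suc (length (lcp x y))

-- Finite sets of leaves are represented by the list of their elements
-- in increasing (left-to-right) order  x₁ < x₂ < … < x_t.

gaps : {n : ℕ} → List (Vec Bool n) → List ℕ
gaps []               = []
gaps (x ∷ [])         = []
gaps (x ∷ y ∷ xs)     = δ x y ∷ gaps (y ∷ xs)

strictDecᵇ : List ℕ → Bool
strictDecᵇ []           = true
strictDecᵇ (a ∷ [])     = true
strictDecᵇ (a ∷ b ∷ xs) = (b <ᵇ a) ∧ strictDecᵇ (b ∷ xs)

strictIncᵇ : List ℕ → Bool
strictIncᵇ []           = true
strictIncᵇ (a ∷ [])     = true
strictIncᵇ (a ∷ b ∷ xs) = (a <ᵇ b) ∧ strictIncᵇ (b ∷ xs)

atLeast3ᵇ : {A : Set} → List A → Bool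
atLeast3ᵇ (_ ∷ _ ∷ _ ∷ _) = true
atLeast3ᵇ _               = false

leftCombᵇ : {n : ℕ} → List (Vec Bool n) → Bool
leftCombᵇ X = atLeast3ᵇ X ∧ strictDecᵇ (gaps X)

rightCombᵇ : {n : ℕ} → List (Vec Bool n) → Bool
rightCombᵇ X = atLeast3ᵇ X ∧ strictIncᵇ (gaps X)

-- π(X) ⊆ [N]; level d ∈ [N] is represented by i : Fin N with toℕ i + 1 = d.
π : {N : ℕ} → List (Vec Bool N) → Subset N
π {N} X = tabulate (λ i → if any (λ d → suc (toℕ i) ≡ᵇ d) (gaps X) then inside else outside)

isPrefixᵇ : List Bool → List Bool → Bool
isPrefixᵇ []      _       = true
isPrefixᵇ (a ∷ w) []      = false
isPrefixᵇ (a ∷ w) (b ∷ v) = eqBool a b ∧ isPrefixᵇ w v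

inSubtreeᵇ : {n : ℕ} → List Bool → Vec Bool n → Bool
inSubtreeᵇ w x = isPrefixᵇ w (toList x)

firstL : {A : Set} → A → List A → A
firstL d []      = d
firstL d (x ∷ _) = x

lastL : {A : Set} → A → List A → A
lastL d []       = d
lastL d (x ∷ xs) = lastL x xs

-- u_X = a(min X, max X)  (only used for |X| ≥ 2; X sorted increasingly)
uX : {n : ℕ} → Vec Bool n → List (Vec Bool n) → List Bool
uX d X = lcp (firstL d X) (lastL d X)

sizeL : {n : ℕ} → List (Vec Bool n) → ℕ
sizeL []      = 0
sizeL (x ∷ X) = length (filter (λ z → T? (inSubtreeᵇ (uX x (x ∷ X) ++ (false ∷ [])) z)) (x ∷ X))

sizeR : {n : ℕ} → List (Vec Bool n) → ℕ
sizeR []      = 0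
sizeR (x ∷ X) = length (filter (λ z → T? (inSubtreeᵇ (uX x (x ∷ X) ++ (true ∷ [])) z)) (x ∷ X))

ℤ₄ : Set
ℤ₄ = Fin 4

3-_ : ℤ₄ → ℤ₄
3- fzero                         = fsuc (fsuc (fsuc fzero))
3- fsuc fzero                    = fsuc (fsuc fzero)
3- fsuc (fsuc fzero)             = fsuc fzero
3- fsuc (fsuc (fsuc fzero))      = fzero

z0 z1 z2 : ℤ₄
z0 = fzero
z1 = fsuc fzero
z2 = fsuc (fsuc fzero)

-- χ_c(X) for a k-set X given as its increasing list of elements.
-- (The final fallbacks are never reached for genuine k-sets: every 3-set is
-- a comb, and every k-set that is not a comb is a balanced, (k-1,1)- or
-- (1,k-1)-split.)
χ : {N : ℕ} → (k : ℕ) → (Subset N → ℤ₄) → List (Vec Bool N) → ℤ₄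
χ 3 c X =
  if leftCombᵇ X then c (π X)
  else if rightCombᵇ X then 3- c (π X)
  else z0
χ k c X =
  if leftCombᵇ X then 3- c (π X)
  else if rightCombᵇ X then c (π X)
  else if (1 <ᵇ sizeL X) ∧ (1 <ᵇ sizeR X) then z0
  else if (sizeL X ≡ᵇ (k ∸ 1)) ∧ (sizeR X ≡ᵇ 1) then z1
  else if (sizeL X ≡ᵇ 1) ∧ (sizeR X ≡ᵇ (k ∸ 1)) then z2
  else z0

elems : {n : ℕ} → Subset n → List (Fin n)
elems []             = []
elems (inside ∷ p)   = fzero ∷ map fsuc (elems p)
elems (outside ∷ p)  = map fsuc (elems p)

{-# OPTIONS --safe #-}
-- The level δ of common ancestors is ultrametric: δ(x, z) ≥ min (δ(x, y), δ(y, z)).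
-- In a left comb y₀ < y₁ < … < y_ℓ this forces δ(yᵢ, yⱼ) = δ(yⱼ₋₁, yⱼ) for i < j, and
-- this survives replacing y₀ by any leaf w between y₀ and y₁.  Hence for J ⊆ {2, …, ℓ}
-- the set {w} ∪ {yⱼ : j ∈ J} is again a left comb, with π = {δ(yⱼ₋₁, yⱼ) : j ∈ J}.
-- These gaps are strictly decreasing, hence distinct, so every (k−1)-subset S of
-- π(Y ∖ {y₀}) is π of such a comb with |J| = k − 1.  On left combs χ_c is c ∘ π or
-- 3 − c ∘ π, depending on k only, so c(S) is determined by α.
module Submission where

open import Defs
open import Data.Nat using (ℕ; suc; _≤_; _∸_)
open import Data.Fin using (Fin; toℕ; _<_) renaming (zero to fzero; suc to fsuc)
open import Data.Fin.Subset using (Subset; _∈_; _⊆_; ∣_∣)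
open import Data.List using (List; _∷_; map; allFin)
open import Data.Bool using (true)
open import Data.Product using (_×_)
open import Relation.Binary.PropositionalEquality using (_≡_)

open import Data.Bool using (Bool; false; T; if_then_else_)
open import Data.Bool.ListAction using (any)
open import Data.Bool.Properties using (T-∧; T-≡)
open import Data.Fin using (inject₁)
import Data.Fin.Properties as Fin
open import Data.Fin.Subset using (inside; outside; _∉_; _-_; ⁅_⁆; Empty)
open import Data.Fin.Subset.Properties
  using (_∈?_; Empty-unique; ∣⊥∣≡0; p─⊥≡p; p─q⊆p; x∈p∧x≢y⇒x∈p-y; ⊆-antisym)
open import Data.List using ([]; length)
import Data.List as List
open import Data.List.Membership.Propositional using () renaming (_∈_ to _∈ˡ_)
open import Data.List.Membership.Propositional.Properties using (∈-map⁺; ∈-map⁻; ∈-tabulate⁻)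
open import Data.List.Properties using (map-∘; map-cong; map-tabulate; length-map)
open import Data.List.Relation.Unary.All using (All; []; _∷_)
import Data.List.Relation.Unary.All as All
import Data.List.Relation.Unary.All.Properties as All
open import Data.List.Relation.Unary.Any using (here; there)
import Data.List.Relation.Unary.Any as Any
open import Data.List.Relation.Unary.Any.Properties using (any⁺; any⁻)
open import Data.Nat using (zero; _>_; _≡ᵇ_; z≤n; s≤s; s<s; z<s)
open import Data.Nat.Properties
open import Data.Product using (∃; _,_; proj₁; proj₂)
open import Data.Sum using (inj₁; inj₂)
open import Data.Unit using (tt)
open import Data.Vec using (Vec; []; _∷_; lookup; here; there)
import Data.Vec as Vec
open import Data.Vec.Properties using (lookup∘tabulate; []=⇒lookup; lookup⇒[]=)
import Data.Vec.Functional as Vector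
open import Function using (_∘_; id; _⇔_; mk⇔; Equivalence)
open import Function.Definitions using (Injective)
open import Relation.Binary.Core using (_Preserves_⟶_)
open import Relation.Binary.Definitions using (tri<; tri≈; tri>)
open import Relation.Binary.PropositionalEquality
  using (_≢_; refl; sym; trans; cong; subst; subst₂; module ≡-Reasoning)
open import Relation.Nullary using (¬_; yes; no; contradiction)
open ≡-Reasoning

private
  variable
    m n N : ℕ

-- The ultrametric δ on leaves

δ-sym : (x y : Vec Bool n) → δ x y ≡ δ y x
δ-sym []          []          = refl
δ-sym (true ∷ x)  (true ∷ y)  = cong suc (δ-sym x y)
δ-sym (false ∷ x) (false ∷ y) = cong suc (δ-sym x y)
δ-sym (true ∷ x)  (false ∷ y) = refl
δ-sym (false ∷ x) (true ∷ y)  = refl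

δ-ultrametric : ∀ {a} (x y z : Vec Bool n) → a ≤ δ x y → a ≤ δ y z → a ≤ δ x z
δ-ultrametric {a = zero}        _           _           _           _       _       = z≤n
δ-ultrametric {a = suc zero}    _           _           _           _       _       = s≤s z≤n
δ-ultrametric                   (true ∷ x)  (true ∷ y)  (true ∷ z)  (s≤s p) (s≤s q) =
  s≤s (δ-ultrametric x y z p q)
δ-ultrametric                   (false ∷ x) (false ∷ y) (false ∷ z) (s≤s p) (s≤s q) =
  s≤s (δ-ultrametric x y z p q)
δ-ultrametric {a = suc (suc _)} []          []          []          (s≤s ()) _
δ-ultrametric {a = suc (suc _)} (true ∷ x)  (false ∷ y) _           (s≤s ()) _
δ-ultrametric {a = suc (suc _)} (false ∷ x) (true ∷ y)  _           (s≤s ()) _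
δ-ultrametric {a = suc (suc _)} (true ∷ x)  (true ∷ y)  (false ∷ z) _        (s≤s ())
δ-ultrametric {a = suc (suc _)} (false ∷ x) (false ∷ y) (true ∷ z)  _        (s≤s ())

δ-isosceles : (w v z : Vec Bool n) → δ w v > δ v z → δ w z ≡ δ v z
δ-isosceles w v z wv>vz = ≤-antisym (≮⇒≥ wz≯vz) (δ-ultrametric w v z (<⇒≤ wv>vz) ≤-refl)
  where
  wz≯vz : ¬ δ w z > δ v z
  wz≯vz wz>vz = n≮n _ (δ-ultrametric v w z (subst (_> δ v z) (δ-sym w v) wv>vz) wz>vz)

δ≤δ-self : (x y : Vec Bool n) → δ x y ≤ δ y y
δ≤δ-self []          []          = ≤-refl
δ≤δ-self (true ∷ x)  (true ∷ y)  = s≤s (δ≤δ-self x y)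
δ≤δ-self (false ∷ x) (false ∷ y) = s≤s (δ≤δ-self x y)
δ≤δ-self (true ∷ x)  (false ∷ y) = s≤s z≤n
δ≤δ-self (false ∷ x) (true ∷ y)  = s≤s z≤n

δ-monoˡ-< : {x w z : Vec Bool n} → x <ᴸ w → w <ᴸ z → δ x z ≤ δ w z
δ-monoˡ-< here                    (there _)   = s≤s z≤n
δ-monoˡ-< (there _)               here        = s≤s z≤n
δ-monoˡ-< (there {b = true} x<w)  (there w<z) = s≤s (δ-monoˡ-< x<w w<z)
δ-monoˡ-< (there {b = false} x<w) (there w<z) = s≤s (δ-monoˡ-< x<w w<z)

δ-monoˡ : {x w z : Vec Bool n} → x ≤ᴸ w → w ≤ᴸ z → δ x z ≤ δ w z
δ-monoˡ         (inj₁ refl) _           = ≤-refl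
δ-monoˡ {x = x} (inj₂ _)    (inj₁ refl) = δ≤δ-self x _
δ-monoˡ         (inj₂ x<w)  (inj₂ w<z)  = δ-monoˡ-< x<w w<z

branchLevel : {x y : Vec Bool n} → x <ᴸ y → Fin n
branchLevel here      = fzero
branchLevel (there l) = fsuc (branchLevel l)

δ≡1+branchLevel : {x y : Vec Bool n} (l : x <ᴸ y) → δ x y ≡ suc (toℕ (branchLevel l))
δ≡1+branchLevel here                  = refl
δ≡1+branchLevel (there {b = true} l)  = cong suc (δ≡1+branchLevel l)
δ≡1+branchLevel (there {b = false} l) = cong suc (δ≡1+branchLevel l)

Decreasing : (Fin n → ℕ) → Set
Decreasing D = D Preserves _<_ ⟶ _>_

Decreasing⇒injective : {D : Fin n → ℕ} → Decreasing D → Injective _≡_ _≡_ D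
Decreasing⇒injective dec {i} {j} Di≡Dj with Fin.<-cmp i j
... | tri< i<j _ _ = contradiction (sym Di≡Dj) (<⇒≢ (dec i<j))
... | tri≈ _ i≡j _ = i≡j
... | tri> _ _ j<i = contradiction Di≡Dj (<⇒≢ (dec j<i))

strictDecᵇ⇒Decreasing : (D : Fin n → ℕ) → T (strictDecᵇ (List.tabulate D)) → Decreasing D
strictDecᵇ⇒Decreasing {n = suc (suc n)} D sd {fzero} {fsuc fzero} _ =
  <ᵇ⇒< _ _ (proj₁ (Equivalence.to T-∧ sd))
strictDecᵇ⇒Decreasing {n = suc (suc n)} D sd {fzero} {fsuc (fsuc j)} _ =
  <-trans (strictDecᵇ⇒Decreasing (D ∘ fsuc) (proj₂ (Equivalence.to T-∧ sd)) {fzero} {fsuc j} z<s)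
          (<ᵇ⇒< _ _ (proj₁ (Equivalence.to T-∧ sd)))
strictDecᵇ⇒Decreasing {n = suc (suc n)} D sd {fsuc i} {fsuc j} (s<s i<j) =
  strictDecᵇ⇒Decreasing (D ∘ fsuc) (proj₂ (Equivalence.to T-∧ sd)) i<j

strictDecᵇ-∷ : {a : ℕ} {xs : List ℕ} → All (a >_) xs → T (strictDecᵇ xs) → T (strictDecᵇ (a ∷ xs))
strictDecᵇ-∷ []        _  = tt
strictDecᵇ-∷ (b<a ∷ _) sd = Equivalence.from T-∧ (<⇒<ᵇ b<a , sd)

strictDecᵇ-map-elems : {D : Fin n → ℕ} → Decreasing D → (p : Subset n) →
  T (strictDecᵇ (map D (elems p)))
strictDecᵇ-map-fsuc-elems : {D : Fin (suc n) → ℕ} → Decreasing D → (p : Subset n) →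
  T (strictDecᵇ (map D (map fsuc (elems p))))

strictDecᵇ-map-elems dec []            = tt
strictDecᵇ-map-elems dec (outside ∷ p) = strictDecᵇ-map-fsuc-elems dec p
strictDecᵇ-map-elems dec (inside ∷ p)  =
  strictDecᵇ-∷ (All.map⁺ (All.map⁺ (All.universal (λ _ → dec z<s) (elems p))))
               (strictDecᵇ-map-fsuc-elems dec p)

strictDecᵇ-map-fsuc-elems dec p =
  subst (T ∘ strictDecᵇ) (map-∘ (elems p)) (strictDecᵇ-map-elems (λ i<j → dec (s<s i<j)) p)

preimage : (Fin m → Fin n) → Subset n → Subset m
preimage f p = Vec.tabulate (lookup p ∘ f)

∈-preimage⁺ : (f : Fin m → Fin n) (p : Subset n) {i : Fin m} → f i ∈ p → i ∈ preimage f p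
∈-preimage⁺ f p {i} fi∈p =
  lookup⇒[]= i (preimage f p) (trans (lookup∘tabulate _ i) ([]=⇒lookup fi∈p))

∈-preimage⁻ : (f : Fin m → Fin n) (p : Subset n) {i : Fin m} → i ∈ preimage f p → f i ∈ p
∈-preimage⁻ f p {i} i∈ =
  lookup⇒[]= (f i) p (trans (sym (lookup∘tabulate _ i)) ([]=⇒lookup i∈))

x∉p-x : {p : Subset n} {x : Fin n} → x ∉ p - x
x∉p-x {p = _ ∷ p} {fsuc x} (there x∈p-x) = x∉p-x {p = p} x∈p-x

∣p∣≡1+∣p-x∣ : {p : Subset n} {x : Fin n} → x ∈ p → ∣ p ∣ ≡ suc ∣ p - x ∣
∣p∣≡1+∣p-x∣ {p = inside ∷ p}  here        = cong suc (sym (cong ∣_∣ (p─⊥≡p p)))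
∣p∣≡1+∣p-x∣ {p = inside ∷ p}  (there x∈p) = cong suc (∣p∣≡1+∣p-x∣ x∈p)
∣p∣≡1+∣p-x∣ {p = outside ∷ p} (there x∈p) = ∣p∣≡1+∣p-x∣ x∈p

∣preimage∣ : {f : Fin m → Fin n} {p : Subset n} → Injective _≡_ _≡_ f →
  (∀ {x} → x ∈ p → ∃ λ i → f i ≡ x) → ∣ preimage f p ∣ ≡ ∣ p ∣
∣preimage∣ {m = zero} {n} {p = p} _ onto = sym (trans (cong ∣_∣ (Empty-unique empty)) (∣⊥∣≡0 n))
  where
  empty : Empty p
  empty (x , x∈p) with () ← proj₁ (onto x∈p)
∣preimage∣ {m = suc m} {f = f} {p} f-inj onto with f fzero ∈? p
... | yes f₀∈p = begin
  ∣ preimage f p ∣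
    ≡⟨ cong (λ s → ∣ s ∷ preimage (f ∘ fsuc) p ∣) ([]=⇒lookup f₀∈p) ⟩
  suc ∣ preimage (f ∘ fsuc) p ∣
    ≡⟨ cong (suc ∘ ∣_∣) (⊆-antisym remove⁺ remove⁻) ⟩
  suc ∣ preimage (f ∘ fsuc) (p - f fzero) ∣
    ≡⟨ cong suc (∣preimage∣ (Fin.suc-injective ∘ f-inj) onto⁻) ⟩
  suc ∣ p - f fzero ∣
    ≡⟨ ∣p∣≡1+∣p-x∣ f₀∈p ⟨
  ∣ p ∣ ∎
  where
  fsuc≢fzero : ∀ {i} → f (fsuc i) ≢ f fzero
  fsuc≢fzero e with () ← f-inj e
  remove⁺ : preimage (f ∘ fsuc) p ⊆ preimage (f ∘ fsuc) (p - f fzero)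
  remove⁺ i∈ =
    ∈-preimage⁺ (f ∘ fsuc) _ (x∈p∧x≢y⇒x∈p-y (∈-preimage⁻ (f ∘ fsuc) p i∈) fsuc≢fzero)
  remove⁻ : preimage (f ∘ fsuc) (p - f fzero) ⊆ preimage (f ∘ fsuc) p
  remove⁻ i∈ =
    ∈-preimage⁺ (f ∘ fsuc) p (p─q⊆p p ⁅ f fzero ⁆ (∈-preimage⁻ (f ∘ fsuc) (p - f fzero) i∈))
  onto⁻ : ∀ {x} → x ∈ p - f fzero → ∃ λ i → f (fsuc i) ≡ x
  onto⁻ x∈ with onto (p─q⊆p p ⁅ f fzero ⁆ x∈)
  ... | fzero  , refl = contradiction x∈ x∉p-x
  ... | fsuc i , e    = i , e
... | no f₀∉p = begin
  ∣ preimage f p ∣          ≡⟨ cong (λ s → ∣ s ∷ preimage (f ∘ fsuc) p ∣) f₀-outside ⟩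
  ∣ preimage (f ∘ fsuc) p ∣ ≡⟨ ∣preimage∣ (Fin.suc-injective ∘ f-inj) onto⁻ ⟩
  ∣ p ∣                     ∎
  where
  f₀-outside : lookup p (f fzero) ≡ outside
  f₀-outside with lookup p (f fzero) in e
  ... | inside  = contradiction (lookup⇒[]= _ p e) f₀∉p
  ... | outside = refl
  onto⁻ : ∀ {x} → x ∈ p → ∃ λ i → f (fsuc i) ≡ x
  onto⁻ x∈ with onto x∈
  ... | fzero  , refl = contradiction x∈ f₀∉p
  ... | fsuc i , e    = i , e

∈-elems⁺ : {p : Subset n} {x : Fin n} → x ∈ p → x ∈ˡ elems p
∈-elems⁺ {p = inside ∷ p}  here        = here refl
∈-elems⁺ {p = inside ∷ p}  (there x∈p) = there (∈-map⁺ fsuc (∈-elems⁺ x∈p))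
∈-elems⁺ {p = outside ∷ p} (there x∈p) = ∈-map⁺ fsuc (∈-elems⁺ x∈p)

∈-elems⁻ : {p : Subset n} {x : Fin n} → x ∈ˡ elems p → x ∈ p
∈-elems⁻ {p = inside ∷ p}  (here refl) = here
∈-elems⁻ {p = inside ∷ p}  (there x∈)  with ∈-map⁻ fsuc x∈
... | _ , x∈p , refl = there (∈-elems⁻ x∈p)
∈-elems⁻ {p = outside ∷ p} x∈          with ∈-map⁻ fsuc x∈
... | _ , x∈p , refl = there (∈-elems⁻ x∈p)

length-elems : (p : Subset n) → length (elems p) ≡ ∣ p ∣
length-elems []            = refl
length-elems (inside ∷ p)  = cong suc (trans (length-map fsuc (elems p)) (length-elems p))
length-elems (outside ∷ p) = trans (length-map fsuc (elems p)) (length-elems p)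

-- Gaps of combs

gap : (Fin (suc n) → Leaf N) → Fin n → ℕ
gap z i = δ (z (inject₁ i)) (z (fsuc i))

gaps-tabulate : (z : Fin (suc n) → Leaf N) → gaps (List.tabulate z) ≡ List.tabulate (gap z)
gaps-tabulate {n = zero}  z = refl
gaps-tabulate {n = suc n} z = cong (δ (z fzero) (z (fsuc fzero)) ∷_) (gaps-tabulate (z ∘ fsuc))

gaps-allFin : (z : Fin (suc n) → Leaf N) → gaps (map z (allFin (suc n))) ≡ List.tabulate (gap z)
gaps-allFin z = trans (cong gaps (map-tabulate id z)) (gaps-tabulate z)

leftCombᵇ⇒Decreasing : (z : Fin (suc n) → Leaf N) → T (leftCombᵇ (map z (allFin (suc n)))) →
  Decreasing (gap z)
leftCombᵇ⇒Decreasing z lc = strictDecᵇ⇒Decreasing (gap z)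
  (subst (T ∘ strictDecᵇ) (gaps-allFin z) (proj₂ (Equivalence.to T-∧ lc)))

leftCombᵇ-intro : {x : Leaf N} {xs : List (Leaf N)} → 2 ≤ length xs →
  T (strictDecᵇ (gaps (x ∷ xs))) → T (leftCombᵇ (x ∷ xs))
leftCombᵇ-intro {xs = _ ∷ _ ∷ _} _ sd = sd
leftCombᵇ-intro {xs = []}        ()
leftCombᵇ-intro {xs = _ ∷ []}    (s≤s ())

replaceHead-Decreasing : (z : Fin (suc (suc n)) → Leaf N) {w : Leaf N} → Decreasing (gap z) →
  z fzero ≤ᴸ w → w ≤ᴸ z (fsuc fzero) → Decreasing (gap (w Vector.∷ Vector.tail z))
replaceHead-Decreasing z dec lo hi {fzero}  {fsuc j} _         =
  <-≤-trans (dec {fzero} {fsuc j} z<s) (δ-monoˡ lo hi)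
replaceHead-Decreasing z dec lo hi {fsuc i} {fsuc j} (s<s i<j) = dec (s<s i<j)

gap-removeSecond : (z : Fin (suc (suc n)) → Leaf N) → Decreasing (gap z) →
  ∀ i → gap (Vector.removeAt z (fsuc fzero)) i ≡ gap z (fsuc i)
gap-removeSecond z dec fzero    =
  δ-isosceles (z fzero) (z (fsuc fzero)) (z (fsuc (fsuc fzero))) (dec {fzero} {fsuc fzero} z<s)
gap-removeSecond z dec (fsuc i) = refl

gaps-subcomb : (z : Fin (suc n) → Leaf N) → Decreasing (gap z) → (p : Subset n) →
  gaps (z fzero ∷ map (z ∘ fsuc) (elems p)) ≡ map (gap z) (elems p)
gaps-subcomb z dec [] = refl
gaps-subcomb z dec (inside ∷ p) = begin
  gaps (z fzero ∷ z (fsuc fzero) ∷ map (z ∘ fsuc) (map fsuc (elems p)))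
    ≡⟨ cong (λ xs → gaps (z fzero ∷ z (fsuc fzero) ∷ xs)) (map-∘ (elems p)) ⟨
  gap z fzero ∷ gaps (z (fsuc fzero) ∷ map (z ∘ fsuc ∘ fsuc) (elems p))
    ≡⟨ cong (gap z fzero ∷_) (gaps-subcomb (z ∘ fsuc) (λ i<j → dec (s<s i<j)) p) ⟩
  gap z fzero ∷ map (gap z ∘ fsuc) (elems p)
    ≡⟨ cong (gap z fzero ∷_) (map-∘ (elems p)) ⟩
  map (gap z) (elems (inside ∷ p)) ∎
gaps-subcomb {n = suc n} {N} z dec (outside ∷ p) = begin
  gaps (z fzero ∷ map (z ∘ fsuc) (map fsuc (elems p)))
    ≡⟨ cong (λ xs → gaps (z fzero ∷ xs)) (map-∘ (elems p)) ⟨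
  gaps (z′ fzero ∷ map (z′ ∘ fsuc) (elems p))
    ≡⟨ gaps-subcomb z′ dec′ p ⟩
  map (gap z′) (elems p)
    ≡⟨ map-cong (gap-removeSecond z dec) (elems p) ⟩
  map (gap z ∘ fsuc) (elems p)
    ≡⟨ map-∘ (elems p) ⟩
  map (gap z) (elems (outside ∷ p)) ∎
  where
  z′ : Fin (suc n) → Leaf N
  z′ = Vector.removeAt z (fsuc fzero)
  dec′ : Decreasing (gap z′)
  dec′ {i} {j} i<j =
    subst₂ _>_ (sym (gap-removeSecond z dec i)) (sym (gap-removeSecond z dec j)) (dec (s<s i<j))

lookup-π : (X : List (Leaf N)) (x : Fin N) →
  lookup (π X) x ≡ any (λ d → suc (toℕ x) ≡ᵇ d) (gaps X)
lookup-π X x = trans (lookup∘tabulate _ x) (if-id (any (λ d → suc (toℕ x) ≡ᵇ d) (gaps X)))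
  where
  if-id : ∀ b → (if b then inside else outside) ≡ b
  if-id true  = refl
  if-id false = refl

∈π⇔ : (X : List (Leaf N)) {x : Fin N} → x ∈ π X ⇔ suc (toℕ x) ∈ˡ gaps X
∈π⇔ X {x} = mk⇔
  (λ x∈ → Any.map (≡ᵇ⇒≡ _ _)
    (any⁻ _ (gaps X) (Equivalence.from T-≡ (trans (sym (lookup-π X x)) ([]=⇒lookup x∈)))))
  (λ x∈ → lookup⇒[]= x (π X)
    (trans (lookup-π X x) (Equivalence.to T-≡ (any⁺ _ (Any.map (≡⇒≡ᵇ _ _) x∈)))))

leftCombColour : ℕ → ℤ₄ → ℤ₄
leftCombColour 3 a = a
leftCombColour _ a = 3- a

3-‿involutive : (a : ℤ₄) → 3- (3- a) ≡ a
3-‿involutive fzero                      = refl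
3-‿involutive (fsuc fzero)               = refl
3-‿involutive (fsuc (fsuc fzero))        = refl
3-‿involutive (fsuc (fsuc (fsuc fzero))) = refl

leftCombColour-injective : {k : ℕ} {a b : ℤ₄} → 3 ≤ k →
  leftCombColour k a ≡ leftCombColour k b → a ≡ b
leftCombColour-injective {k = 3}                               _ e = e
leftCombColour-injective {k = suc (suc (suc (suc _)))} {a} {b} _ e =
  trans (sym (3-‿involutive a)) (trans (cong 3-_ e) (3-‿involutive b))
leftCombColour-injective {k = 1} (s≤s ())
leftCombColour-injective {k = 2} (s≤s (s≤s ()))

χ-leftComb : {k : ℕ} {c : Subset N → ℤ₄} {X : List (Leaf N)} → 3 ≤ k → T (leftCombᵇ X) →
  χ k c X ≡ leftCombColour k (c (π X))
χ-leftComb {k = 3}                       _ lc rewrite Equivalence.to T-≡ lc = refl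
χ-leftComb {k = suc (suc (suc (suc _)))} _ lc rewrite Equivalence.to T-≡ lc = refl
χ-leftComb {k = 1} (s≤s ())
χ-leftComb {k = 2} (s≤s (s≤s ()))

-- Sub-combs of a left comb y₀ < y₁ < … < y_{ℓ+1}

module SubComb {N ℓ : ℕ} (y : Fin (suc (suc ℓ)) → Leaf N)
               (y-increasing : ∀ i j → i < j → y i <ᴸ y j)
               (y-comb : Decreasing (gap y)) where

  tail-Decreasing : Decreasing (gap (Vector.tail y))
  tail-Decreasing i<j = y-comb (s<s i<j)

  Y∖y₀ : List (Leaf N)
  Y∖y₀ = map (λ i → y (fsuc i)) (allFin (suc ℓ))

  -- level j is the position in π of the gap δ(y (j + 1), y (j + 2)).
  level : Fin ℓ → Fin N
  level j = branchLevel
    (y-increasing (fsuc (inject₁ j)) (fsuc (fsuc j)) (s<s (Fin.≤̄⇒inject₁< Fin.≤-refl)))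

  gap≡1+level : ∀ j → gap (Vector.tail y) j ≡ suc (toℕ (level j))
  gap≡1+level j = δ≡1+branchLevel _

  level-unique : {x : Fin N} {j : Fin ℓ} → suc (toℕ x) ≡ gap (Vector.tail y) j → level j ≡ x
  level-unique {j = j} e = Fin.toℕ-injective (suc-injective (sym (trans e (gap≡1+level j))))

  level-injective : Injective _≡_ _≡_ level
  level-injective {i} {j} e = Decreasing⇒injective tail-Decreasing
    (trans (gap≡1+level i) (trans (cong (suc ∘ toℕ) e) (sym (gap≡1+level j))))

  levels-cover : {x : Fin N} → x ∈ π Y∖y₀ → ∃ λ j → level j ≡ x
  levels-cover x∈
    with ∈-tabulate⁻ (subst (_ ∈ˡ_) (gaps-allFin (Vector.tail y)) (Equivalence.to (∈π⇔ Y∖y₀) x∈))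
  ... | j , e = j , level-unique e

  indicesOf : Subset N → Subset (suc (suc ℓ))
  indicesOf S = outside ∷ outside ∷ preimage level S

  indicesOf-≥2 : (S : Subset N) → ∀ j → j ∈ indicesOf S → 2 ≤ toℕ j
  indicesOf-≥2 _ (fsuc (fsuc j)) _          = s≤s (s≤s z≤n)
  indicesOf-≥2 _ fzero           ()
  indicesOf-≥2 _ (fsuc fzero)    (there ())

  ∣indicesOf∣ : {S : Subset N} → S ⊆ π Y∖y₀ → ∣ indicesOf S ∣ ≡ ∣ S ∣
  ∣indicesOf∣ S⊆ = ∣preimage∣ level-injective (levels-cover ∘ S⊆)

  subcombFrom : Leaf N → Subset ℓ → List (Leaf N)
  subcombFrom w P = w ∷ map y (elems (outside ∷ outside ∷ P))

  module _ {w : Leaf N} (lo : y fzero ≤ᴸ w) (hi : w ≤ᴸ y (fsuc fzero)) where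

    gaps-subcombFrom : (P : Subset ℓ) →
      gaps (subcombFrom w P) ≡ map (gap (Vector.tail y)) (elems P)
    gaps-subcombFrom P = begin
      gaps (w ∷ map y (map fsuc (map fsuc (elems P))))
        ≡⟨ cong (λ xs → gaps (w ∷ xs)) (map-∘ (map fsuc (elems P))) ⟨
      gaps (z fzero ∷ map (z ∘ fsuc) (elems (outside ∷ P)))
        ≡⟨ gaps-subcomb z (replaceHead-Decreasing y y-comb lo hi) (outside ∷ P) ⟩
      map (gap z) (map fsuc (elems P))
        ≡⟨ map-∘ (elems P) ⟨
      map (gap (Vector.tail y)) (elems P) ∎
      where
      z : Fin (suc (suc ℓ)) → Leaf N
      z = w Vector.∷ Vector.tail y

    subcombFrom-leftComb : (P : Subset ℓ) → 2 ≤ ∣ P ∣ → T (leftCombᵇ (subcombFrom w P))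
    subcombFrom-leftComb P 2≤∣P∣ = leftCombᵇ-intro {x = w} {xs = map y (elems J)}
      (subst (2 ≤_) (sym (trans (length-map y (elems J)) (length-elems J))) 2≤∣P∣)
      (subst (T ∘ strictDecᵇ) (sym (gaps-subcombFrom P)) (strictDecᵇ-map-elems tail-Decreasing P))
      where
      J : Subset (suc (suc ℓ))
      J = outside ∷ outside ∷ P

    π-subcombFrom : {S : Subset N} → S ⊆ π Y∖y₀ → π (subcombFrom w (preimage level S)) ≡ S
    π-subcombFrom {S} S⊆ = ⊆-antisym π⊆S S⊆π
      where
      X : List (Leaf N)
      X = subcombFrom w (preimage level S)
      gaps-X : gaps X ≡ map (gap (Vector.tail y)) (elems (preimage level S))
      gaps-X = gaps-subcombFrom (preimage level S)
      π⊆S : π X ⊆ S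
      π⊆S x∈
        with ∈-map⁻ (gap (Vector.tail y)) (subst (_ ∈ˡ_) gaps-X (Equivalence.to (∈π⇔ X) x∈))
      ... | j , j∈ , e = subst (_∈ S) (level-unique e) (∈-preimage⁻ level S (∈-elems⁻ j∈))
      S⊆π : S ⊆ π X
      S⊆π x∈ with levels-cover (S⊆ x∈)
      ... | j , refl = Equivalence.from (∈π⇔ X) (subst (suc (toℕ (level j)) ∈ˡ_) (sym gaps-X)
        (subst (_∈ˡ map (gap (Vector.tail y)) (elems (preimage level S))) (gap≡1+level j)
          (∈-map⁺ (gap (Vector.tail y)) (∈-elems⁺ (∈-preimage⁺ level S x∈)))))

proposition2p7 : (N ℓ k : ℕ) → 3 ≤ k → k ≤ ℓ → ℓ ≤ N →
    (c : Subset N → ℤ₄) →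
    (y : Fin (suc ℓ) → Leaf N) →
    (∀ i j → i < j → y i <ᴸ y j) →
    leftCombᵇ (map y (allFin (suc ℓ))) ≡ true →
    (yJ : Subset (suc ℓ) → Leaf N) →
    (∀ J → (∀ j → j ∈ J → 2 ≤ toℕ j) → ∣ J ∣ ≡ k ∸ 1 →
       y fzero ≤ᴸ yJ J × (∀ j → toℕ j ≡ 1 → yJ J ≤ᴸ y j)) →
    (α : ℤ₄) →
    (∀ J → (∀ j → j ∈ J → 2 ≤ toℕ j) → ∣ J ∣ ≡ k ∸ 1 →
       χ k c (yJ J ∷ map y (elems J)) ≡ α) →
    (S T : Subset N) →
    S ⊆ π (map (λ i → y (fsuc i)) (allFin ℓ)) →
    T ⊆ π (map (λ i → y (fsuc i)) (allFin ℓ)) →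
    ∣ S ∣ ≡ k ∸ 1 → ∣ T ∣ ≡ k ∸ 1 →
    c S ≡ c T
proposition2p7 _ zero _ (s≤s _) ()
proposition2p7 N (suc ℓ) k 3≤k _ _ c y y-increasing Y-comb yJ yJ-between α χ≡α
               S T S⊆ T⊆ ∣S∣ ∣T∣ =
  leftCombColour-injective 3≤k (trans (colour S⊆ ∣S∣) (sym (colour T⊆ ∣T∣)))
  where
  open SubComb y y-increasing (leftCombᵇ⇒Decreasing y (Equivalence.from T-≡ Y-comb))

  colour : {R : Subset N} → R ⊆ π Y∖y₀ → ∣ R ∣ ≡ k ∸ 1 → leftCombColour k (c R) ≡ α
  colour {R} R⊆ ∣R∣ = begin
    leftCombColour k (c R)
      ≡⟨ cong (leftCombColour k ∘ c) (π-subcombFrom lo hi R⊆) ⟨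
    leftCombColour k (c (π X))
      ≡⟨ χ-leftComb 3≤k (subcombFrom-leftComb lo hi (preimage level R) 2≤∣J∣) ⟨
    χ k c X
      ≡⟨ χ≡α J (indicesOf-≥2 R) ∣J∣ ⟩
    α ∎
    where
    J : Subset (suc (suc ℓ))
    J = indicesOf R
    X : List (Leaf N)
    X = yJ J ∷ map y (elems J)
    ∣J∣ : ∣ J ∣ ≡ k ∸ 1
    ∣J∣ = trans (∣indicesOf∣ R⊆) ∣R∣
    2≤∣J∣ : 2 ≤ ∣ J ∣
    2≤∣J∣ = subst (2 ≤_) (sym ∣J∣) (∸-monoˡ-≤ 1 3≤k)
    lo : y fzero ≤ᴸ yJ J
    lo = proj₁ (yJ-between J (indicesOf-≥2 R) ∣J∣)
    hi : yJ J ≤ᴸ y (fsuc fzero)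
    hi = proj₂ (yJ-between J (indicesOf-≥2 R) ∣J∣) (fsuc fzero) refl
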